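{- For a graph $G$ the following are equivalent: (a) $G=\mathcal{C}\langle M\rangle$ for some left-quasigroup $M$; (b) $G=\mathcal{C}\langle M\rangle$ for some left-quasigroup $M$ with a left identity; (c) $G$ is simple, deterministic, complete and source-complete. Likewise, the following are equivalent: (a') $G=\mathcal{C}\langle M\rangle$ for some left-quasigroup $M$ with a right identity; (b') $G=\mathcal{C}\langle M\rangle$ for some left-quasigroup $M$ with an identity; (c') $G$ is simple, deterministic, complete, source-complete and loop-complete.
   Context: A graph is a non-empty set $G\subseteq V\times A\times V$ of labeled edges $s\xrightarrow{a}_G t$; $V_G$ is the set of vertices occurring in edges, $A_G$ the set of labels. For a magma $(M,\cdot)$ and an injective map $\langle\,\rangle:M\to A$, $\mathcal{C}\langle M\rangle=\{(p,\langle q\rangle,p\cdot q): p,q\in M\}$ (the statement allows any such injective labeling). A magma is a left-quasigroup if for all $p,q$ there is a unique $r$ with $p\cdot r=q$. Left identity: $e\cdot p=p$ for all $p$; right identity: $p\cdot e=p$ for all $p$; identity: both. $G$ is simple if no two edges share source and target; deterministic if $r\xrightarrow{a}s$, $r\xrightarrow{a}t$ imply $s=t$; complete if for all $s,t\in V_G$ there is an edge from $s$ to $t$; source-complete if for every $s\in V_G$ and $a\in A_G$ there is $t$ with $s\xrightarrow{a}_G t$; loop-complete if whenever some vertex has an $a$-labeled loop, every vertex has an $a$-labeled loop. -}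

module Defs where

open import Data.Product using (Σ; ∃; ∃-syntax; _×_; _,_)
open import Data.Sum using (_⊎_)
open import Function.Bundles using (_⇔_)
open import Relation.Binary.PropositionalEquality using (_≡_)

-- A graph on vertex type V and label type A is a subset G ⊆ V × A × V,
-- given as a relation  Edge s a t  ("s --a--> t in G").  Since G is a *set*,
-- membership is proof-irrelevant (IsPropGraph); non-emptiness is NonEmpty.
Graph : Set → Set → Set₁
Graph V A = V → A → V → Set

module _ {V A : Set} (G : Graph V A) where

  IsPropGraph : Set
  IsPropGraph = ∀ {s a t} (x y : G s a t) → x ≡ y

  NonEmpty : Set
  NonEmpty = ∃[ s ] ∃[ a ] ∃[ t ] G s a t

  IsVertex : V → Set
  IsVertex v = (∃[ a ] ∃[ t ] G v a t) ⊎ (∃[ s ] ∃[ a ] G s a v)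

  IsLabel : A → Set
  IsLabel a = ∃[ s ] ∃[ t ] G s a t

  Simple : Set
  Simple = ∀ {s t a b} → G s a t → G s b t → a ≡ b

  Deterministic : Set
  Deterministic = ∀ {r s t a} → G r a s → G r a t → s ≡ t

  Complete : Set
  Complete = ∀ s t → IsVertex s → IsVertex t → ∃[ a ] G s a t

  SourceComplete : Set
  SourceComplete = ∀ s a → IsVertex s → IsLabel a → ∃[ t ] G s a t

  LoopComplete : Set
  LoopComplete = ∀ a → (∃[ v ] G v a v) → ∀ w → IsVertex w → G w a w

record Magma : Set₁ where
  field
    Carrier : Set
    _∙_     : Carrier → Carrier → Carrier

module _ (M : Magma) where
  open Magma M

  IsLeftQuasigroup : Set
  IsLeftQuasigroup = ∀ p q → Σ Carrier λ r → (p ∙ r ≡ q) × (∀ r′ → p ∙ r′ ≡ q → r ≡ r′)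

  IsLeftIdentity : Carrier → Set
  IsLeftIdentity e = ∀ p → e ∙ p ≡ p

  IsRightIdentity : Carrier → Set
  IsRightIdentity e = ∀ p → p ∙ e ≡ p

  IsIdentity : Carrier → Set
  IsIdentity e = IsLeftIdentity e × IsRightIdentity e

  HasLeftIdentity : Set
  HasLeftIdentity = ∃[ e ] IsLeftIdentity e

  HasRightIdentity : Set
  HasRightIdentity = ∃[ e ] IsRightIdentity e

  HasIdentity : Set
  HasIdentity = ∃[ e ] IsIdentity e

Injective : {X Y : Set} → (X → Y) → Set
Injective f = ∀ {x y} → f x ≡ f y → x ≡ y

-- G = C⟨M⟩: the elements of M are vertices (M ⊆ V, via an injective map ι),
-- ⟨_⟩ : M → A is an injective labeling, and the edges of G are exactly
-- ι p --⟨q⟩--> ι (p ∙ q).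
IsCayleyOf : {V A : Set} → Graph V A → Magma → Set
IsCayleyOf {V} {A} G M =
  Σ (Carrier → V) λ ι → Injective ι ×
  Σ (Carrier → A) λ lab → Injective lab ×
  (∀ s a t → G s a t ⇔ (∃[ p ] ∃[ q ] (s ≡ ι p × a ≡ lab q × t ≡ ι (p ∙ q))))
  where open Magma M

CayleyWith : {V A : Set} → Graph V A → (Magma → Set) → Set₁
CayleyWith G P = Σ Magma λ M → P M × IsCayleyOf G M

module Submission where

-- Every edge of C⟨M⟩ is determined by its source and label, so C⟨M⟩ is deterministic
-- and source-complete for every magma; left division makes it complete and left
-- cancellation makes it simple, and a right identity e puts an ⟨e⟩-loop on every vertex.
-- Conversely, fix a vertex s₀ of a graph with the four properties and let M be the set
-- of edges out of s₀.  Such an edge is determined by its target (simplicity) and by its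
-- label (determinism), so M names both the vertices and the labels of G, and
-- p ∙ q := the target of the ⟨q⟩-edge out of p turns G into C⟨M⟩.  This M is a left
-- quasigroup whose left identity is the loop at s₀, which is also a right identity as
-- soon as G is loop-complete.

open import Defs
open import Algebra.Definitions using (LeftCancellative)
open import Data.Product using (_×_; Σ; ∃-syntax; _,_; proj₁; proj₂)
open import Data.Sum using (inj₁; inj₂)
open import Function using (_∘_)
open import Function.Bundles using (_⇔_; mk⇔; Equivalence)
open import Relation.Binary.PropositionalEquality using (_≡_; refl; sym; trans; cong; subst)

IsLeftCancellative : Magma → Set
IsLeftCancellative M = LeftCancellative (_≡_ {A = Carrier}) _∙_
  where open Magma M

leftQuasigroup⇒leftCancellative : (M : Magma) → IsLeftQuasigroup M → IsLeftCancellative M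
leftQuasigroup⇒leftCancellative M lq p q q′ pq≡pq′ =
  trans (sym (unique q refl)) (unique q′ (sym pq≡pq′))
  where
  open Magma M
  unique : ∀ r → p ∙ r ≡ p ∙ q → proj₁ (lq p (p ∙ q)) ≡ r
  unique = proj₂ (proj₂ (lq p (p ∙ q)))

CayleyWith-mono : {V A : Set} {G : Graph V A} {P Q : Magma → Set} →
                  (∀ M → P M → Q M) → CayleyWith G P → CayleyWith G Q
CayleyWith-mono P⇒Q (M , PM , cayley) = M , P⇒Q M PM , cayley

module CayleyGraph {V A : Set} {G : Graph V A} {M : Magma} (cayley : IsCayleyOf G M) where
  open Magma M

  ι : Carrier → V
  ι = proj₁ cayley

  ι-injective : Injective ι
  ι-injective = proj₁ (proj₂ cayley)

  ⟨_⟩ : Carrier → A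
  ⟨_⟩ = proj₁ (proj₂ (proj₂ cayley))

  ⟨⟩-injective : Injective ⟨_⟩
  ⟨⟩-injective = proj₁ (proj₂ (proj₂ (proj₂ cayley)))

  edges : ∀ s a t → G s a t ⇔ (∃[ p ] ∃[ q ] (s ≡ ι p × a ≡ ⟨ q ⟩ × t ≡ ι (p ∙ q)))
  edges = proj₂ (proj₂ (proj₂ (proj₂ cayley)))

  edge-inv : ∀ {s a t} → G s a t → ∃[ p ] ∃[ q ] (s ≡ ι p × a ≡ ⟨ q ⟩ × t ≡ ι (p ∙ q))
  edge-inv {s} {a} {t} = Equivalence.to (edges s a t)

  edge : ∀ p q → G (ι p) ⟨ q ⟩ (ι (p ∙ q))
  edge p q = Equivalence.from (edges (ι p) ⟨ q ⟩ (ι (p ∙ q))) (p , q , refl , refl , refl)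

  vertex-inv : ∀ {v} → IsVertex G v → ∃[ p ] v ≡ ι p
  vertex-inv (inj₁ (_ , _ , g)) with edge-inv g
  ... | p , _ , s≡ιp , _ = p , s≡ιp
  vertex-inv (inj₂ (_ , _ , g)) with edge-inv g
  ... | p , q , _ , _ , t≡ιpq = p ∙ q , t≡ιpq

  deterministic : Deterministic G
  deterministic g h with edge-inv g | edge-inv h
  ... | p , q , refl , refl , refl | p′ , q′ , ιp≡ιp′ , ⟨q⟩≡⟨q′⟩ , refl
    with ι-injective ιp≡ιp′ | ⟨⟩-injective ⟨q⟩≡⟨q′⟩
  ... | refl | refl = refl

  sourceComplete : SourceComplete G
  sourceComplete s a s∈G (_ , _ , g) with vertex-inv s∈G | edge-inv g
  ... | p , refl | _ , q , _ , refl , _ = ι (p ∙ q) , edge p q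

  simple : IsLeftCancellative M → Simple G
  simple cancel g h with edge-inv g | edge-inv h
  ... | p , q , refl , refl , refl | p′ , q′ , ιp≡ιp′ , refl , ιpq≡ιp′q′
    with ι-injective ιp≡ιp′
  ... | refl = cong ⟨_⟩ (cancel p q q′ (ι-injective ιpq≡ιp′q′))

  complete : IsLeftQuasigroup M → Complete G
  complete lq s t s∈G t∈G with vertex-inv s∈G | vertex-inv t∈G
  ... | p , refl | p′ , refl with lq p p′
  ... | r , pr≡p′ , _ = ⟨ r ⟩ , subst (G (ι p) ⟨ r ⟩ ∘ ι) pr≡p′ (edge p r)

  -- A loop ι p --⟨q⟩--> ι p forces p ∙ q ≡ p ≡ p ∙ e, hence q ≡ e by cancellation.
  loopComplete : IsLeftCancellative M → HasRightIdentity M → LoopComplete G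
  loopComplete cancel (e , pe≡p) a (_ , g) w w∈G with edge-inv g | vertex-inv w∈G
  ... | p , q , refl , refl , ιp≡ιpq | p′ , refl
    with cancel p q e (trans (sym (ι-injective ιp≡ιpq)) (sym (pe≡p p)))
  ... | refl = subst (G (ι p′) ⟨ e ⟩ ∘ ι) (pe≡p p′) (edge p′ e)

module Reconstruction {V A : Set} (G : Graph V A) (prop : IsPropGraph G)
  (s₀ : V) (s₀∈G : IsVertex G s₀)
  (simple : Simple G) (deterministic : Deterministic G)
  (complete : Complete G) (sourceComplete : SourceComplete G) where

  Out : Set
  Out = Σ V λ v → Σ A λ a → G s₀ a v

  ι : Out → V
  ι = proj₁

  ⟨_⟩ : Out → A
  ⟨ _ , a , _ ⟩ = a

  ι-vertex : (p : Out) → IsVertex G (ι p)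
  ι-vertex (_ , a , g) = inj₂ (s₀ , a , g)

  ⟨⟩-label : (p : Out) → IsLabel G ⟨ p ⟩
  ⟨⟩-label (v , _ , g) = s₀ , v , g

  out : (v : V) → IsVertex G v → Out
  out v v∈G = v , complete s₀ v s₀∈G v∈G

  ι-injective : Injective ι
  ι-injective {v , a , g} {.v , b , h} refl with simple g h
  ... | refl with prop g h
  ... | refl = refl

  ⟨⟩-injective : Injective ⟨_⟩
  ⟨⟩-injective {_ , a , g} {_ , .a , h} refl = ι-injective (deterministic g h)

  step : (p q : Out) → ∃[ t ] G (ι p) ⟨ q ⟩ t
  step p q = sourceComplete (ι p) ⟨ q ⟩ (ι-vertex p) (⟨⟩-label q)

  _∙_ : Out → Out → Out
  p ∙ q = out (proj₁ (step p q)) (inj₂ (ι p , ⟨ q ⟩ , proj₂ (step p q)))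

  edge : ∀ p q → G (ι p) ⟨ q ⟩ (ι (p ∙ q))
  edge p q = proj₂ (step p q)

  magma : Magma
  magma = record { Carrier = Out ; _∙_ = _∙_ }

  with-label : ∀ {s a t} → G s a t → Out
  with-label {s} {a} {t} g = proj₁ (sourceComplete s₀ a s₀∈G (s , t , g)) , a ,
                             proj₂ (sourceComplete s₀ a s₀∈G (s , t , g))

  edges : ∀ s a t → G s a t ⇔ (∃[ p ] ∃[ q ] (s ≡ ι p × a ≡ ⟨ q ⟩ × t ≡ ι (p ∙ q)))
  edges s a t = mk⇔ to from
    where
    to : G s a t → ∃[ p ] ∃[ q ] (s ≡ ι p × a ≡ ⟨ q ⟩ × t ≡ ι (p ∙ q))
    to g = p , with-label g , refl , refl , deterministic g (edge p (with-label g))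
      where p = out s (inj₁ (a , t , g))
    from : (∃[ p ] ∃[ q ] (s ≡ ι p × a ≡ ⟨ q ⟩ × t ≡ ι (p ∙ q))) → G s a t
    from (p , q , refl , refl , refl) = edge p q

  cayley : IsCayleyOf G magma
  cayley = ι , ι-injective , ⟨_⟩ , ⟨⟩-injective , edges

  -- The quotient of q by p is the edge out of s₀ labelled like the edge ι p → ι q.
  leftQuasigroup : IsLeftQuasigroup magma
  leftQuasigroup p q with complete (ι p) (ι q) (ι-vertex p) (ι-vertex q)
  ... | a , g with sourceComplete s₀ a s₀∈G (ι p , ι q , g)
  ... | v , h = r , ι-injective (deterministic (edge p r) g) , unique
    where
    r : Out
    r = v , a , h
    unique : ∀ r′ → p ∙ r′ ≡ q → r ≡ r′
    unique r′ refl = ⟨⟩-injective (simple g (edge p r′))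

  e : Out
  e = out s₀ s₀∈G

  leftIdentity : IsLeftIdentity magma e
  leftIdentity q@(_ , _ , g) = ι-injective (deterministic (edge e q) g)

  rightIdentity : LoopComplete G → IsRightIdentity magma e
  rightIdentity loopComplete p = ι-injective (deterministic (edge p e) loop)
    where
    loop : G (ι p) ⟨ e ⟩ (ι p)
    loop = loopComplete ⟨ e ⟩ (s₀ , proj₂ (proj₂ e)) (ι p) (ι-vertex p)

module _ {V A : Set} {G : Graph V A} where

  leftQuasigroupCayley⇒properties : CayleyWith G IsLeftQuasigroup →
    Simple G × Deterministic G × Complete G × SourceComplete G
  leftQuasigroupCayley⇒properties (M , lq , cayley) =
    simple (leftQuasigroup⇒leftCancellative M lq) , deterministic , complete lq , sourceComplete
    where open CayleyGraph cayley

  rightIdentityCayley⇒properties :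
    CayleyWith G (λ M → IsLeftQuasigroup M × HasRightIdentity M) →
    Simple G × Deterministic G × Complete G × SourceComplete G × LoopComplete G
  rightIdentityCayley⇒properties (M , (lq , e) , cayley) =
    simple cancel , deterministic , complete lq , sourceComplete , loopComplete cancel e
    where
    open CayleyGraph cayley
    cancel : IsLeftCancellative M
    cancel = leftQuasigroup⇒leftCancellative M lq

  leftIdentityCayley⇒leftQuasigroupCayley :
    CayleyWith G (λ M → IsLeftQuasigroup M × HasLeftIdentity M) → CayleyWith G IsLeftQuasigroup
  leftIdentityCayley⇒leftQuasigroupCayley = CayleyWith-mono (λ _ → proj₁)

  identityCayley⇒rightIdentityCayley :
    CayleyWith G (λ M → IsLeftQuasigroup M × HasIdentity M) →
    CayleyWith G (λ M → IsLeftQuasigroup M × HasRightIdentity M)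
  identityCayley⇒rightIdentityCayley = CayleyWith-mono (λ _ (lq , e , _ , right) → lq , e , right)

  properties⇒leftIdentityCayley : IsPropGraph G → NonEmpty G →
    Simple G × Deterministic G × Complete G × SourceComplete G →
    CayleyWith G (λ M → IsLeftQuasigroup M × HasLeftIdentity M)
  properties⇒leftIdentityCayley prop (s₀ , a₀ , t₀ , g₀) (s , d , c , sc) =
    magma , (leftQuasigroup , e , leftIdentity) , cayley
    where open Reconstruction G prop s₀ (inj₁ (a₀ , t₀ , g₀)) s d c sc

  properties⇒identityCayley : IsPropGraph G → NonEmpty G →
    Simple G × Deterministic G × Complete G × SourceComplete G × LoopComplete G →
    CayleyWith G (λ M → IsLeftQuasigroup M × HasIdentity M)
  properties⇒identityCayley prop (s₀ , a₀ , t₀ , g₀) (s , d , c , sc , lc) =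
    magma , (leftQuasigroup , e , leftIdentity , rightIdentity lc) , cayley
    where open Reconstruction G prop s₀ (inj₁ (a₀ , t₀ , g₀)) s d c sc

proposition6p2 : {V A : Set} (G : Graph V A) → IsPropGraph G → NonEmpty G →
    ((CayleyWith G IsLeftQuasigroup ⇔ CayleyWith G (λ M → IsLeftQuasigroup M × HasLeftIdentity M))
     × (CayleyWith G (λ M → IsLeftQuasigroup M × HasLeftIdentity M)
          ⇔ (Simple G × Deterministic G × Complete G × SourceComplete G)))
    × ((CayleyWith G (λ M → IsLeftQuasigroup M × HasRightIdentity M)
          ⇔ CayleyWith G (λ M → IsLeftQuasigroup M × HasIdentity M))
       × (CayleyWith G (λ M → IsLeftQuasigroup M × HasIdentity M)
          ⇔ (Simple G × Deterministic G × Complete G × SourceComplete G × LoopComplete G)))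
proposition6p2 G prop nonEmpty =
  ( mk⇔ (properties⇒leftIdentityCayley prop nonEmpty ∘ leftQuasigroupCayley⇒properties)
        leftIdentityCayley⇒leftQuasigroupCayley
  , mk⇔ (leftQuasigroupCayley⇒properties ∘ leftIdentityCayley⇒leftQuasigroupCayley)
        (properties⇒leftIdentityCayley prop nonEmpty) )
  , ( mk⇔ (properties⇒identityCayley prop nonEmpty ∘ rightIdentityCayley⇒properties)
          identityCayley⇒rightIdentityCayley
    , mk⇔ (rightIdentityCayley⇒properties ∘ identityCayley⇒rightIdentityCayley)
          (properties⇒identityCayley prop nonEmpty) )
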